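{- For $\lambda\in(0,1]$, let $U$ be a densest subgraph of $G$ (a nonempty $U\subseteq V$ maximizing $|E(U)|/|U|$) and let $L$ be the labeling that labels every edge weak. Then $(U,L)$ satisfies the STC property in $(U,E(U))$ and $q(U,L;\lambda)\ge \lambda\, q(U^*,L^*;\lambda)$, where $(U^*,L^*)$ is an optimal solution of \textsc{stc-den}; that is, this gives a $\frac{1}{\lambda}$-approximation for \textsc{stc-den}.
   Context: Let $G=(V,E)$ be a finite simple undirected unweighted graph. For $U\subseteq V$, $E(U)$ is the set of edges with both endpoints in $U$. A labeling $L$ assigns each edge the label strong or weak. A labeling satisfies the strong triadic closure (STC) property in $(U,E(U))$ if for all distinct $x,y,z\in U$ with $(x,y),(y,z)\in E(U)$ both labeled strong, we have $(x,z)\in E$. Let $m_s(U,L)$ and $m_w(U,L)$ be the numbers of strong and weak edges in $E(U)$. For $\lambda\in[0,1]$ and nonempty $U$, the score is $q(U,L;\lambda)=\frac{m_s(U,L)+\lambda m_w(U,L)}{|U|}$. Problem \textsc{stc-den}: given $G$ and $\lambda$, find a nonempty $U\subseteq V$ and a labeling $L$ satisfying the STC property in $(U,E(U))$ that maximizes $q(U,L;\lambda)$.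
   Formalization: The parameter λ ranges over the rationals in (0,1]. -}

module Defs where

open import Data.Nat as ℕ using (ℕ; zero; suc)
open import Data.Bool using (Bool; true; false; if_then_else_; _∧_)
open import Data.Fin using (Fin; _<?_)
open import Data.Fin.Subset using (Subset; _∈_; ∣_∣; Nonempty)
open import Data.Fin.Subset.Properties using (_∈?_)
open import Data.List using (List; map; allFin)
open import Data.Nat.ListAction using (sum)
open import Data.Integer using (+_)
open import Data.Rational using (ℚ; _/_; _*_; _+_; 0ℚ)
open import Relation.Nullary.Decidable using (⌊_⌋)
open import Relation.Binary.PropositionalEquality using (_≡_)

record Graph (n : ℕ) : Set where
  field
    adj     : Fin n → Fin n → Bool
    adj-sym : ∀ x y → adj x y ≡ adj y x
    irrefl  : ∀ x → adj x x ≡ false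
open Graph public

data Label : Set where
  strong weak : Label

-- A labeling assigns a label to each unordered pair {x,y}; we represent it
-- as a function and always read it through `lab`, which looks up the value
-- at the ordered pair (min, max), so the label of an edge is well defined.
Labeling : ℕ → Set
Labeling n = Fin n → Fin n → Label

lab : ∀ {n} → Labeling n → Fin n → Fin n → Label
lab L x y = if ⌊ x <? y ⌋ then L x y else L y x

isStrong : Label → Bool
isStrong strong = true
isStrong weak   = false

isWeak : Label → Bool
isWeak strong = false
isWeak weak   = true

Edge : ∀ {n} → Graph n → Fin n → Fin n → Set
Edge G x y = adj G x y ≡ true

STC : ∀ {n} → Graph n → Subset n → Labeling n → Set
STC G U L = ∀ x y z → x ∈ U → y ∈ U → z ∈ U →
  x ≢ y → y ≢ z → x ≢ z → Edge G x y → Edge G y z →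
  lab L x y ≡ strong → lab L y z ≡ strong → Edge G x z
  where open import Relation.Binary.PropositionalEquality using (_≢_)

countEdges : ∀ {n} → Graph n → Subset n → (Fin n → Fin n → Bool) → ℕ
countEdges {n} G U p = sum (map (λ i → sum (map (λ j →
  if ⌊ i <? j ⌋ ∧ ⌊ i ∈? U ⌋ ∧ ⌊ j ∈? U ⌋ ∧ adj G i j ∧ p i j then 1 else 0)
  (allFin n))) (allFin n))

numEdges : ∀ {n} → Graph n → Subset n → ℕ
numEdges G U = countEdges G U (λ _ _ → true)

m-s : ∀ {n} → Graph n → Subset n → Labeling n → ℕ
m-s G U L = countEdges G U (λ x y → isStrong (lab L x y))

m-w : ∀ {n} → Graph n → Subset n → Labeling n → ℕ
m-w G U L = countEdges G U (λ x y → isWeak (lab L x y))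

-- x / k as a rational; the value at k = 0 is a dummy (only used for nonempty U)
divℕ : ℚ → ℕ → ℚ
divℕ x zero    = 0ℚ
divℕ x (suc k) = x * ((+ 1) / suc k)

toℚ : ℕ → ℚ
toℚ k = (+ k) / 1

density : ∀ {n} → Graph n → Subset n → ℚ
density G U = divℕ (toℚ (numEdges G U)) ∣ U ∣

score : ∀ {n} → Graph n → Subset n → Labeling n → ℚ → ℚ
score G U L λ' = divℕ (toℚ (m-s G U L) + λ' * toℚ (m-w G U L)) ∣ U ∣

Densest : ∀ {n} → Graph n → Subset n → Set
Densest G U = Nonempty U × (∀ U' → Nonempty U' → density G U' ≤ density G U)
  where open import Data.Product using (_×_)
        open import Data.Rational using (_≤_)

Optimal : ∀ {n} → Graph n → ℚ → Subset n → Labeling n → Set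
Optimal G λ' U L = Nonempty U × STC G U L ×
  (∀ U' L' → Nonempty U' → STC G U' L' → score G U' L' λ' ≤ score G U L λ')
  where open import Data.Product using (_×_)
        open import Data.Rational using (_≤_)

allWeak : ∀ {n} → Labeling n
allWeak _ _ = weak

{-# OPTIONS --safe #-}
-- Since λ ≤ 1, every labeling has m_s + λ m_w ≤ m_s + m_w = |E(U')|, so the score of any
-- nonempty U' (optimal or not) is at most its density, hence at most the density of the
-- densest subgraph U. The all-weak labeling has no pair of strong edges, so it satisfies
-- STC vacuously, and on U it scores exactly λ times the density of U.
module Submission where

open import Defs
open import Data.Nat using (ℕ)
open import Data.Product using (_×_)
open import Data.Fin.Subset using (Subset)
open import Data.Rational using (ℚ; 0ℚ; 1ℚ; _<_; _≤_; _*_)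

open import Data.Bool using (Bool; true; false; if_then_else_; _∧_)
open import Data.Fin using (Fin; _<?_)
open import Data.Fin.Subset using (∣_∣)
open import Data.Fin.Subset.Properties using (_∈?_)
open import Data.Integer as ℤ using (+_)
import Data.Integer.Properties as ℤₚ
open import Data.List using ([]; _∷_; map; allFin)
open import Data.List.Properties using (map-cong)
import Data.Nat as ℕ
import Data.Nat.Properties as ℕₚ
open import Algebra.Properties.CommutativeSemigroup ℕₚ.+-commutativeSemigroup
  using (interchange)
open import Data.Nat.ListAction using (sum)
open import Data.Product using (_,_)
open import Data.Rational using (_+_; _/_; NonNegative; toℚᵘ; nonNegative)
open import Data.Rational.Properties
  using ( ≤-refl; ≤-trans; <⇒≤; ≤-reflexive; +-identityˡ; +-monoʳ-≤; *-assoc; *-zeroʳ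
        ; *-identityˡ; *-monoˡ-≤-nonNeg; *-monoʳ-≤-nonNeg; normalize-nonNeg
        ; toℚᵘ-injective; toℚᵘ-fromℚᵘ; toℚᵘ-homo-+; module ≤-Reasoning)
import Data.Rational.Unnormalised as ℚᵘ
import Data.Rational.Unnormalised.Properties as ℚᵘₚ
open import Function using (case_of_)
open import Relation.Nullary.Decidable using (⌊_⌋)
open import Relation.Binary.PropositionalEquality

indicator : Bool → ℕ
indicator b = if b then 1 else 0

indicator-∧-+ : ∀ a {x y z} → indicator x ℕ.+ indicator y ≡ indicator z →
  indicator (a ∧ x) ℕ.+ indicator (a ∧ y) ≡ indicator (a ∧ z)
indicator-∧-+ true  x+y≡z = x+y≡z
indicator-∧-+ false _     = refl

sum-map-+ : ∀ {A : Set} {f g h : A → ℕ} → (∀ x → f x ℕ.+ g x ≡ h x) →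
  ∀ xs → sum (map f xs) ℕ.+ sum (map g xs) ≡ sum (map h xs)
sum-map-+ _ [] = refl
sum-map-+ {f = f} {g} {h} f+g≡h (x ∷ xs) = begin
  (f x ℕ.+ sum (map f xs)) ℕ.+ (g x ℕ.+ sum (map g xs))
    ≡⟨ interchange (f x) _ (g x) _ ⟩
  (f x ℕ.+ g x) ℕ.+ (sum (map f xs) ℕ.+ sum (map g xs))
    ≡⟨ cong₂ ℕ._+_ (f+g≡h x) (sum-map-+ f+g≡h xs) ⟩
  h x ℕ.+ sum (map h xs) ∎
  where open ≡-Reasoning

lab-allWeak : ∀ {n} (x y : Fin n) → lab allWeak x y ≡ weak
lab-allWeak x y with ⌊ x <? y ⌋
... | true  = refl
... | false = refl

allWeak-STC : ∀ {n} (G : Graph n) (U : Subset n) → STC G U allWeak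
allWeak-STC G U x y _ _ _ _ _ _ _ _ _ xy-strong _ =
  case trans (sym (lab-allWeak x y)) xy-strong of λ ()

module _ {n} (G : Graph n) (U : Subset n) where

  countEdges-+ : ∀ {p q r} →
    (∀ i j → indicator (p i j) ℕ.+ indicator (q i j) ≡ indicator (r i j)) →
    countEdges G U p ℕ.+ countEdges G U q ≡ countEdges G U r
  countEdges-+ p+q≡r = sum-map-+ (λ i → sum-map-+ (λ j →
    indicator-∧-+ ⌊ i <? j ⌋ (indicator-∧-+ ⌊ i ∈? U ⌋ (indicator-∧-+ ⌊ j ∈? U ⌋
      (indicator-∧-+ (adj G i j) (p+q≡r i j))))) (allFin n)) (allFin n)

  countEdges-cong : ∀ {p q} → (∀ i j → p i j ≡ q i j) → countEdges G U p ≡ countEdges G U q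
  countEdges-cong p≡q = cong sum (map-cong (λ i → cong sum (map-cong (λ j →
    cong (λ b → indicator (⌊ i <? j ⌋ ∧ ⌊ i ∈? U ⌋ ∧ ⌊ j ∈? U ⌋ ∧ adj G i j ∧ b)) (p≡q i j))
    (allFin n))) (allFin n))

  m-s+m-w≡numEdges : ∀ L → m-s G U L ℕ.+ m-w G U L ≡ numEdges G U
  m-s+m-w≡numEdges L = countEdges-+ (λ i j → strong-or-weak (lab L i j))
    where
    strong-or-weak : ∀ l → indicator (isStrong l) ℕ.+ indicator (isWeak l) ≡ 1
    strong-or-weak strong = refl
    strong-or-weak weak   = refl

  m-w-allWeak : m-w G U allWeak ≡ numEdges G U
  m-w-allWeak = countEdges-cong (λ i j → cong isWeak (lab-allWeak i j))

  m-s-allWeak : m-s G U allWeak ≡ 0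
  m-s-allWeak = ℕₚ.+-cancelʳ-≡ (m-w G U allWeak) _ 0
    (trans (m-s+m-w≡numEdges allWeak) (sym m-w-allWeak))

toℚ-+ : ∀ a b → toℚ (a ℕ.+ b) ≡ toℚ a + toℚ b
toℚ-+ a b = toℚᵘ-injective (begin
  toℚᵘ (toℚ (a ℕ.+ b))              ≈⟨ toℚᵘ-fromℚᵘ (ℚᵘ.mkℚᵘ (+ (a ℕ.+ b)) 0) ⟩
  ℚᵘ.mkℚᵘ (+ (a ℕ.+ b)) 0           ≈⟨ ℚᵘ.*≡* (cong (ℤ._* + 1) (sym numerators-+)) ⟩
  ℚᵘ.mkℚᵘ (+ a) 0 ℚᵘ.+ ℚᵘ.mkℚᵘ (+ b) 0
    ≈⟨ ℚᵘₚ.+-cong (ℚᵘₚ.≃-sym (toℚᵘ-fromℚᵘ (ℚᵘ.mkℚᵘ (+ a) 0)))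
                  (ℚᵘₚ.≃-sym (toℚᵘ-fromℚᵘ (ℚᵘ.mkℚᵘ (+ b) 0))) ⟩
  toℚᵘ (toℚ a) ℚᵘ.+ toℚᵘ (toℚ b)    ≈⟨ ℚᵘₚ.≃-sym (toℚᵘ-homo-+ (toℚ a) (toℚ b)) ⟩
  toℚᵘ (toℚ a + toℚ b)              ∎)
  where
  open ℚᵘₚ.≃-Reasoning
  numerators-+ : + a ℤ.* + 1 ℤ.+ + b ℤ.* + 1 ≡ + (a ℕ.+ b)
  numerators-+ = trans (cong₂ ℤ._+_ (ℤₚ.*-identityʳ (+ a)) (ℤₚ.*-identityʳ (+ b)))
                       (sym (ℤₚ.pos-+ a b))

divℕ-monoˡ-≤ : ∀ k {x y} → x ≤ y → divℕ x k ≤ divℕ y k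
divℕ-monoˡ-≤ ℕ.zero    _   = ≤-refl
divℕ-monoˡ-≤ (ℕ.suc k) x≤y = *-monoʳ-≤-nonNeg (+ 1 / ℕ.suc k) {{normalize-nonNeg 1 (ℕ.suc k)}} x≤y

*-divℕ-assoc : ∀ p x k → p * divℕ x k ≡ divℕ (p * x) k
*-divℕ-assoc p x ℕ.zero    = *-zeroʳ p
*-divℕ-assoc p x (ℕ.suc k) = sym (*-assoc p x (+ 1 / ℕ.suc k))

score≤density : ∀ {n} (G : Graph n) (U : Subset n) (L : Labeling n) {λ' : ℚ} →
  λ' ≤ 1ℚ → score G U L λ' ≤ density G U
score≤density G U L {λ'} λ≤1 = divℕ-monoˡ-≤ ∣ U ∣ (begin
  toℚ s + λ' * toℚ w    ≤⟨ +-monoʳ-≤ (toℚ s) weighted-weak≤weak ⟩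
  toℚ s + toℚ w         ≡⟨ toℚ-+ s w ⟨
  toℚ (s ℕ.+ w)         ≡⟨ cong toℚ (m-s+m-w≡numEdges G U L) ⟩
  toℚ (numEdges G U)    ∎)
  where
  open ≤-Reasoning
  s = m-s G U L
  w = m-w G U L
  weighted-weak≤weak : λ' * toℚ w ≤ toℚ w
  weighted-weak≤weak = ≤-trans (*-monoʳ-≤-nonNeg (toℚ w) {{normalize-nonNeg w 1}} λ≤1)
                               (≤-reflexive (*-identityˡ (toℚ w)))

score-allWeak : ∀ {n} (G : Graph n) (U : Subset n) (λ' : ℚ) →
  score G U allWeak λ' ≡ λ' * density G U
score-allWeak G U λ' = begin
  divℕ (toℚ (m-s G U allWeak) + λ' * toℚ (m-w G U allWeak)) ∣ U ∣
    ≡⟨ cong₂ (λ s w → divℕ (toℚ s + λ' * toℚ w) ∣ U ∣) (m-s-allWeak G U) (m-w-allWeak G U) ⟩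
  divℕ (0ℚ + λ' * toℚ (numEdges G U)) ∣ U ∣
    ≡⟨ cong (λ x → divℕ x ∣ U ∣) (+-identityˡ (λ' * toℚ (numEdges G U))) ⟩
  divℕ (λ' * toℚ (numEdges G U)) ∣ U ∣
    ≡⟨ *-divℕ-assoc λ' (toℚ (numEdges G U)) ∣ U ∣ ⟨
  λ' * density G U ∎
  where open ≡-Reasoning

mainTheorem3 : ∀ {n} (G : Graph n) (λ' : ℚ) → 0ℚ < λ' → λ' ≤ 1ℚ →
    (U : Subset n) → Densest G U →
    (U* : Subset n) (L* : Labeling n) → Optimal G λ' U* L* →
    STC G U allWeak × λ' * score G U* L* λ' ≤ score G U allWeak λ'
mainTheorem3 G λ' 0<λ λ≤1 U (_ , densest) U* L* (U*-nonempty , _ , _) =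
  allWeak-STC G U , (begin
    λ' * score G U* L* λ' ≤⟨ *-monoˡ-≤-nonNeg λ' score*≤density ⟩
    λ' * density G U      ≡⟨ score-allWeak G U λ' ⟨
    score G U allWeak λ'  ∎)
  where
  open ≤-Reasoning
  instance
    λ-nonNeg : NonNegative λ'
    λ-nonNeg = nonNegative (<⇒≤ 0<λ)
  score*≤density : score G U* L* λ' ≤ density G U
  score*≤density = ≤-trans (score≤density G U* L* λ≤1) (densest U* U*-nonempty)
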